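{- The category $\mathbf{Petri}$ of Petri nets and etale maps has pushouts and coequalisers over unit graphs, and they are calculated pointwise (separately on the $S,I,T,O$ components). Every Petri net is the colimit of a diagram of elementary graphs over unit graphs (transitions glued along places).
   Context: A Petri net is a diagram of finite sets $S\leftarrow I\to T\leftarrow O\to S$ with no conditions; a morphism consists of maps on the four sets (same map on both copies of $S$) making all squares commute, and it is etale if the two middle squares (over $T'\to T$) are pullbacks. The unit graph is $1\leftarrow\emptyset\to\emptyset\leftarrow\emptyset\to1$; a corolla is $m+n\leftarrow m\to1\leftarrow n\to m+n$; elementary graphs are the unit graph and corollas. "Pushouts and coequalisers over unit graphs" are colimits of diagrams $\mathsf P_1\leftarrow\mathsf U\to\mathsf P_2$ and $\mathsf U\rightrightarrows\mathsf P$ in which $\mathsf U$ is a unit graph. The diagram in the last sentence has one corolla for each transition, one unit graph for each place, and one etale map from a unit graph into a corolla for each arc. -}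

module Defs where

open import Data.Nat using (ℕ; _+_)
open import Data.Fin using (Fin; zero; _↑ˡ_; _↑ʳ_)
open import Data.Product using (Σ; _×_; _,_)
open import Data.Sum using (_⊎_; inj₁; inj₂)
open import Data.Empty using (⊥-elim)
open import Function using (_∘_; _↔_; Inverse)
open import Relation.Binary.PropositionalEquality using (_≡_; refl; trans; cong; _≗_)

-- Finite sets are represented by Fin n (the skeleton of FinSet).

IsPullbackFin : {a b c p : ℕ} (f : Fin a → Fin c) (g : Fin b → Fin c)
                (p₁ : Fin p → Fin a) (p₂ : Fin p → Fin b) → Set
IsPullbackFin {a} {b} {c} {p} f g p₁ p₂ =
  (f ∘ p₁ ≗ g ∘ p₂) ×
  ((x : ℕ) (h₁ : Fin x → Fin a) (h₂ : Fin x → Fin b) → f ∘ h₁ ≗ g ∘ h₂ →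
     Σ (Fin x → Fin p) λ u →
       (p₁ ∘ u ≗ h₁) × (p₂ ∘ u ≗ h₂) ×
       ((u' : Fin x → Fin p) → p₁ ∘ u' ≗ h₁ → p₂ ∘ u' ≗ h₂ → u' ≗ u))

IsPushoutFin : {u a b q : ℕ} (f₁ : Fin u → Fin a) (f₂ : Fin u → Fin b)
               (g₁ : Fin a → Fin q) (g₂ : Fin b → Fin q) → Set
IsPushoutFin {u} {a} {b} {q} f₁ f₂ g₁ g₂ =
  (g₁ ∘ f₁ ≗ g₂ ∘ f₂) ×
  ((x : ℕ) (h₁ : Fin a → Fin x) (h₂ : Fin b → Fin x) → h₁ ∘ f₁ ≗ h₂ ∘ f₂ →
     Σ (Fin q → Fin x) λ v →
       (v ∘ g₁ ≗ h₁) × (v ∘ g₂ ≗ h₂) ×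
       ((v' : Fin q → Fin x) → v' ∘ g₁ ≗ h₁ → v' ∘ g₂ ≗ h₂ → v' ≗ v))

IsCoequaliserFin : {u a q : ℕ} (f g : Fin u → Fin a) (c : Fin a → Fin q) → Set
IsCoequaliserFin {u} {a} {q} f g c =
  (c ∘ f ≗ c ∘ g) ×
  ((x : ℕ) (h : Fin a → Fin x) → h ∘ f ≗ h ∘ g →
     Σ (Fin q → Fin x) λ v →
       (v ∘ c ≗ h) × ((v' : Fin q → Fin x) → v' ∘ c ≗ h → v' ≗ v))

record Petri : Set where
  field
    S I T O : ℕ
    inS  : Fin I → Fin S
    inT  : Fin I → Fin T
    outT : Fin O → Fin T
    outS : Fin O → Fin S
open Petri public

record Hom (P Q : Petri) : Set where
  field
    fS : Fin (S P) → Fin (S Q)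
    fI : Fin (I P) → Fin (I Q)
    fT : Fin (T P) → Fin (T Q)
    fO : Fin (O P) → Fin (O Q)
    sq-inS  : ∀ i → fS (inS P i) ≡ inS Q (fI i)
    sq-inT  : ∀ i → fT (inT P i) ≡ inT Q (fI i)
    sq-outT : ∀ o → fT (outT P o) ≡ outT Q (fO o)
    sq-outS : ∀ o → fS (outS P o) ≡ outS Q (fO o)
open Hom public

IsEtale : {P Q : Petri} → Hom P Q → Set
IsEtale {P} {Q} f =
  IsPullbackFin (fT f) (inT Q) (inT P) (fI f) ×
  IsPullbackFin (fT f) (outT Q) (outT P) (fO f)

_≈H_ : {P Q : Petri} → Hom P Q → Hom P Q → Set
f ≈H g = (fS f ≗ fS g) × (fI f ≗ fI g) × (fT f ≗ fT g) × (fO f ≗ fO g)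

infixr 9 _∘H_
_∘H_ : {P Q R : Petri} → Hom Q R → Hom P Q → Hom P R
g ∘H f = record
  { fS = fS g ∘ fS f ; fI = fI g ∘ fI f ; fT = fT g ∘ fT f ; fO = fO g ∘ fO f
  ; sq-inS  = λ i → trans (cong (fS g) (sq-inS f i))  (sq-inS g (fI f i))
  ; sq-inT  = λ i → trans (cong (fT g) (sq-inT f i))  (sq-inT g (fI f i))
  ; sq-outT = λ o → trans (cong (fT g) (sq-outT f o)) (sq-outT g (fO f o))
  ; sq-outS = λ o → trans (cong (fS g) (sq-outS f o)) (sq-outS g (fO f o))
  }

unitNet : Petri
unitNet = record
  { S = 1 ; I = 0 ; T = 0 ; O = 0
  ; inS = λ () ; inT = λ () ; outT = λ () ; outS = λ () }

corolla : ℕ → ℕ → Petri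
corolla m n = record
  { S = m + n ; I = m ; T = 1 ; O = n
  ; inS = λ i → i ↑ˡ n ; inT = λ _ → zero ; outT = λ _ → zero ; outS = λ o → m ↑ʳ o }

unitAt : (Q : Petri) → Fin (S Q) → Hom unitNet Q
unitAt Q p = record
  { fS = λ _ → p ; fI = λ () ; fT = λ () ; fO = λ ()
  ; sq-inS = λ () ; sq-inT = λ () ; sq-outT = λ () ; sq-outS = λ () }

unit-etale : {Q : Petri} (f : Hom unitNet Q) → IsEtale f
unit-etale f = (pb (λ ()) , λ x h₁ h₂ _ → h₁ , (λ k → ⊥-elim (no (h₁ k))) ,
                  (λ k → ⊥-elim (no (h₁ k))) , λ u' _ _ k → ⊥-elim (no (h₁ k)))
             , (pb (λ ()) , λ x h₁ h₂ _ → h₁ , (λ k → ⊥-elim (no (h₁ k))) ,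
                  (λ k → ⊥-elim (no (h₁ k))) , λ u' _ _ k → ⊥-elim (no (h₁ k)))
  where
    pb : {A : Set} → A → A
    pb a = a
    no : {A : Set} → Fin 0 → A
    no ()

IsPushoutPetri : {U P₁ P₂ Q : Petri} (f₁ : Hom U P₁) (f₂ : Hom U P₂)
                 (g₁ : Hom P₁ Q) (g₂ : Hom P₂ Q) → Set
IsPushoutPetri {U} {P₁} {P₂} {Q} f₁ f₂ g₁ g₂ =
  ((g₁ ∘H f₁) ≈H (g₂ ∘H f₂)) ×
  ((Q' : Petri) (h₁ : Hom P₁ Q') (h₂ : Hom P₂ Q') → IsEtale h₁ → IsEtale h₂ →
     (h₁ ∘H f₁) ≈H (h₂ ∘H f₂) →
     Σ (Hom Q Q') λ v → IsEtale v × ((v ∘H g₁) ≈H h₁) × ((v ∘H g₂) ≈H h₂) ×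
       ((v' : Hom Q Q') → IsEtale v' → (v' ∘H g₁) ≈H h₁ → (v' ∘H g₂) ≈H h₂ →
          v' ≈H v))

IsCoequaliserPetri : {U P Q : Petri} (f g : Hom U P) (c : Hom P Q) → Set
IsCoequaliserPetri {U} {P} {Q} f g c =
  ((c ∘H f) ≈H (c ∘H g)) ×
  ((Q' : Petri) (h : Hom P Q') → IsEtale h → (h ∘H f) ≈H (h ∘H g) →
     Σ (Hom Q Q') λ v → IsEtale v × ((v ∘H c) ≈H h) ×
       ((v' : Hom Q Q') → IsEtale v' → (v' ∘H c) ≈H h → v' ≈H v))

PointwisePushout : {U P₁ P₂ Q : Petri} (f₁ : Hom U P₁) (f₂ : Hom U P₂)
                   (g₁ : Hom P₁ Q) (g₂ : Hom P₂ Q) → Set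
PointwisePushout f₁ f₂ g₁ g₂ =
  IsPushoutFin (fS f₁) (fS f₂) (fS g₁) (fS g₂) ×
  IsPushoutFin (fI f₁) (fI f₂) (fI g₁) (fI g₂) ×
  IsPushoutFin (fT f₁) (fT f₂) (fT g₁) (fT g₂) ×
  IsPushoutFin (fO f₁) (fO f₂) (fO g₁) (fO g₂)

PointwiseCoequaliser : {U P Q : Petri} (f g : Hom U P) (c : Hom P Q) → Set
PointwiseCoequaliser f g c =
  IsCoequaliserFin (fS f) (fS g) (fS c) ×
  IsCoequaliserFin (fI f) (fI g) (fI c) ×
  IsCoequaliserFin (fT f) (fT g) (fT c) ×
  IsCoequaliserFin (fO f) (fO g) (fO c)

-- General diagrams in Petri indexed by a graph (free category on a
-- graph), cocones and colimits.

record Diagram : Set₁ where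
  field
    V E      : Set
    src tgt  : E → V
    obj      : V → Petri
    arr      : (e : E) → Hom (obj (src e)) (obj (tgt e))
    arr-etale : (e : E) → IsEtale (arr e)
open Diagram public

record Cocone (D : Diagram) (Q : Petri) : Set where
  field
    leg       : (v : V D) → Hom (obj D v) Q
    leg-etale : (v : V D) → IsEtale (leg v)
    commute   : (e : E D) → (leg (tgt D e) ∘H arr D e) ≈H leg (src D e)
open Cocone public

IsColimit : (D : Diagram) (Q : Petri) → Cocone D Q → Set
IsColimit D Q c =
  (Q' : Petri) (c' : Cocone D Q') →
    Σ (Hom Q Q') λ v → IsEtale v × ((x : V D) → (v ∘H leg c x) ≈H leg c' x) ×
      ((v' : Hom Q Q') → IsEtale v' → ((x : V D) → (v' ∘H leg c x) ≈H leg c' x) →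
         v' ≈H v)

InArcs : (P : Petri) → Fin (T P) → Set
InArcs P t = Σ (Fin (I P)) λ i → inT P i ≡ t

OutArcs : (P : Petri) → Fin (T P) → Set
OutArcs P t = Σ (Fin (O P)) λ o → outT P o ≡ t

module _ (P : Petri) (m n : Fin (T P) → ℕ)
         (ein  : (t : Fin (T P)) → Fin (m t) ↔ InArcs P t)
         (eout : (t : Fin (T P)) → Fin (n t) ↔ OutArcs P t) where

  elemObj : Fin (T P) ⊎ Fin (S P) → Petri
  elemObj (inj₁ t) = corolla (m t) (n t)
  elemObj (inj₂ p) = unitNet

  elemSrc : Fin (I P) ⊎ Fin (O P) → Fin (T P) ⊎ Fin (S P)
  elemSrc (inj₁ i) = inj₂ (inS P i)
  elemSrc (inj₂ o) = inj₂ (outS P o)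

  elemTgt : Fin (I P) ⊎ Fin (O P) → Fin (T P) ⊎ Fin (S P)
  elemTgt (inj₁ i) = inj₁ (inT P i)
  elemTgt (inj₂ o) = inj₁ (outT P o)

  elemArr : (e : Fin (I P) ⊎ Fin (O P)) → Hom (elemObj (elemSrc e)) (elemObj (elemTgt e))
  elemArr (inj₁ i) = unitAt (corolla (m (inT P i)) (n (inT P i)))
                       (Inverse.from (ein (inT P i)) (i , refl) ↑ˡ n (inT P i))
  elemArr (inj₂ o) = unitAt (corolla (m (outT P o)) (n (outT P o)))
                       (m (outT P o) ↑ʳ Inverse.from (eout (outT P o)) (o , refl))

  elemArr-etale : (e : Fin (I P) ⊎ Fin (O P)) → IsEtale (elemArr e)
  elemArr-etale (inj₁ i) = unit-etale (elemArr (inj₁ i))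
  elemArr-etale (inj₂ o) = unit-etale (elemArr (inj₂ o))

  elemDiagram : Diagram
  elemDiagram = record
    { V = Fin (T P) ⊎ Fin (S P) ; E = Fin (I P) ⊎ Fin (O P)
    ; src = elemSrc ; tgt = elemTgt ; obj = elemObj
    ; arr = elemArr ; arr-etale = elemArr-etale }

-- Etale maps out of the unit graph only see places, so a pushout over a
-- unit graph is the coproduct of the two nets with two places identified,
-- and a coequaliser is a single net with two places identified; in both
-- cases transitions and arcs are untouched, which is why every mediating
-- map is again etale and the colimit is computed componentwise.
-- A Petri net is glued from the corollas of its transitions because an
-- etale map out of a corolla is the same as a transition of the target
-- together with a bijection of its arcs with those of the corolla: the
-- legs of any cocone therefore assemble into a single etale map.
module Submission where

open import Defs
open import Data.Nat using (ℕ; zero; suc; _+_)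
open import Data.Fin using (Fin; zero; _↑ˡ_; _↑ʳ_; splitAt; punchIn; punchOut)
open import Data.Fin.Properties
  using (_≟_; ↑ˡ-injective; ↑ʳ-injective; splitAt-↑ˡ; splitAt-↑ʳ; splitAt⁻¹-↑ˡ; splitAt⁻¹-↑ʳ;
         punchOut-cong; punchOut-punchIn; punchIn-punchOut; punchInᵢ≢i)
open import Data.Product using (Σ; _×_; _,_; proj₁; proj₂)
open import Data.Product.Properties using (Σ-≡,≡→≡)
open import Data.Sum using (inj₁; inj₂; [_,_]′)
open import Data.Empty using (⊥-elim)
open import Function using (_↔_; _∘_; id; Inverse)
open import Relation.Nullary using (yes; no)
open import Axiom.UniquenessOfIdentityProofs using (module Decidable⇒UIP)
open import Relation.Binary.PropositionalEquality

-- Coproducts of finite sets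

copair : ∀ {a b} {X : Set} → (Fin a → X) → (Fin b → X) → Fin (a + b) → X
copair {a} f g = [ f , g ]′ ∘ splitAt a

copair-↑ˡ : ∀ {a b} {X : Set} (f : Fin a → X) (g : Fin b → X) i → copair f g (i ↑ˡ b) ≡ f i
copair-↑ˡ {a} {b} f g i = cong [ f , g ]′ (splitAt-↑ˡ a i b)

copair-↑ʳ : ∀ {a b} {X : Set} (f : Fin a → X) (g : Fin b → X) j → copair f g (a ↑ʳ j) ≡ g j
copair-↑ʳ {a} {b} f g j = cong [ f , g ]′ (splitAt-↑ʳ a b j)

↑-elim : ∀ {a b} (Pr : Fin (a + b) → Set) →
         (∀ i → Pr (i ↑ˡ b)) → (∀ j → Pr (a ↑ʳ j)) → ∀ x → Pr x
↑-elim {a} Pr left right x with splitAt a x in eq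
... | inj₁ i = subst Pr (splitAt⁻¹-↑ˡ eq) (left i)
... | inj₂ j = subst Pr (splitAt⁻¹-↑ʳ eq) (right j)

↑ˡ≢↑ʳ : ∀ {a b} (i : Fin a) (j : Fin b) → i ↑ˡ b ≢ a ↑ʳ j
↑ˡ≢↑ʳ {a} {b} i j eq
  with () ← trans (sym (splitAt-↑ˡ a i b)) (trans (cong (splitAt a) eq) (splitAt-↑ʳ a b j))

copair-unique : ∀ {a b} {X : Set} {f : Fin a → X} {g : Fin b → X} (v : Fin (a + b) → X) →
                v ∘ (_↑ˡ b) ≗ f → v ∘ (a ↑ʳ_) ≗ g → v ≗ copair f g
copair-unique {f = f} {g} v vˡ vʳ = ↑-elim _
  (λ i → trans (vˡ i) (sym (copair-↑ˡ f g i)))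
  (λ j → trans (vʳ j) (sym (copair-↑ʳ f g j)))

≗copair⇒↑ˡ : ∀ {a b} {X : Set} {f : Fin a → X} {g : Fin b → X} {v : Fin (a + b) → X} →
             v ≗ copair f g → v ∘ (_↑ˡ b) ≗ f
≗copair⇒↑ˡ {f = f} {g} v≗ i = trans (v≗ _) (copair-↑ˡ f g i)

≗copair⇒↑ʳ : ∀ {a b} {X : Set} {f : Fin a → X} {g : Fin b → X} {v : Fin (a + b) → X} →
             v ≗ copair f g → v ∘ (a ↑ʳ_) ≗ g
≗copair⇒↑ʳ {f = f} {g} v≗ j = trans (v≗ _) (copair-↑ʳ f g j)

copair-glue : ∀ {u a b} {X : Set} {f₁ : Fin u → Fin a} {f₂ : Fin u → Fin b}
              (h₁ : Fin a → X) (h₂ : Fin b → X) →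
              h₁ ∘ f₁ ≗ h₂ ∘ f₂ → copair h₁ h₂ ∘ (_↑ˡ b) ∘ f₁ ≗ copair h₁ h₂ ∘ (a ↑ʳ_) ∘ f₂
copair-glue h₁ h₂ sq k = trans (copair-↑ˡ h₁ h₂ _) (trans (sq k) (sym (copair-↑ʳ h₁ h₂ _)))

infixr 6 _⊕_
_⊕_ : ∀ {a b c d} → (Fin a → Fin c) → (Fin b → Fin d) → Fin (a + b) → Fin (c + d)
_⊕_ {c = c} {d} f g = copair ((_↑ˡ d) ∘ f) ((c ↑ʳ_) ∘ g)

⊕-↑ˡ : ∀ {a b c d} (f : Fin a → Fin c) (g : Fin b → Fin d) i → (f ⊕ g) (i ↑ˡ b) ≡ f i ↑ˡ d
⊕-↑ˡ {c = c} {d} f g = copair-↑ˡ ((_↑ˡ d) ∘ f) ((c ↑ʳ_) ∘ g)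

⊕-↑ʳ : ∀ {a b c d} (f : Fin a → Fin c) (g : Fin b → Fin d) j → (f ⊕ g) (a ↑ʳ j) ≡ c ↑ʳ g j
⊕-↑ʳ {c = c} {d} f g = copair-↑ʳ ((_↑ˡ d) ∘ f) ((c ↑ʳ_) ∘ g)

copair-square : ∀ {a₁ a₂ b c d₁ d₂} (f₁ : Fin a₁ → Fin c) (f₂ : Fin a₂ → Fin c) (g : Fin b → Fin c)
                {r₁ : Fin d₁ → Fin a₁} {q₁ : Fin d₁ → Fin b} {r₂ : Fin d₂ → Fin a₂} {q₂ : Fin d₂ → Fin b} →
                f₁ ∘ r₁ ≗ g ∘ q₁ → f₂ ∘ r₂ ≗ g ∘ q₂ →
                copair f₁ f₂ ∘ (r₁ ⊕ r₂) ≗ g ∘ copair q₁ q₂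
copair-square f₁ f₂ g {r₁} {q₁} {r₂} {q₂} sq₁ sq₂ = ↑-elim _
  (λ i → begin
    copair f₁ f₂ ((r₁ ⊕ r₂) (i ↑ˡ _)) ≡⟨ cong (copair f₁ f₂) (⊕-↑ˡ r₁ r₂ i) ⟩
    copair f₁ f₂ (r₁ i ↑ˡ _)          ≡⟨ copair-↑ˡ f₁ f₂ (r₁ i) ⟩
    f₁ (r₁ i)                         ≡⟨ sq₁ i ⟩
    g (q₁ i)                          ≡⟨ cong g (copair-↑ˡ q₁ q₂ i) ⟨
    g (copair q₁ q₂ (i ↑ˡ _))         ∎)
  (λ j → begin
    copair f₁ f₂ ((r₁ ⊕ r₂) (_ ↑ʳ j)) ≡⟨ cong (copair f₁ f₂) (⊕-↑ʳ r₁ r₂ j) ⟩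
    copair f₁ f₂ (_ ↑ʳ r₂ j)          ≡⟨ copair-↑ʳ f₁ f₂ (r₂ j) ⟩
    f₂ (r₂ j)                         ≡⟨ sq₂ j ⟩
    g (q₂ j)                          ≡⟨ cong g (copair-↑ʳ q₁ q₂ j) ⟨
    g (copair q₁ q₂ (_ ↑ʳ j))         ∎)
  where open ≡-Reasoning

-- Pullbacks of finite sets, element by element

record IsPullbackElt {a b c p : ℕ} (f : Fin a → Fin c) (g : Fin b → Fin c)
                     (p₁ : Fin p → Fin a) (p₂ : Fin p → Fin b) : Set where
  field
    commutes         : f ∘ p₁ ≗ g ∘ p₂
    pair             : ∀ x y → f x ≡ g y → Σ (Fin p) λ z → p₁ z ≡ x × p₂ z ≡ y
    jointlyInjective : ∀ z z' → p₁ z ≡ p₁ z' → p₂ z ≡ p₂ z' → z ≡ z'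
open IsPullbackElt

module _ {a b c p : ℕ} {f : Fin a → Fin c} {g : Fin b → Fin c}
         {p₁ : Fin p → Fin a} {p₂ : Fin p → Fin b} where

  IsPullbackElt⇒IsPullbackFin : IsPullbackElt f g p₁ p₂ → IsPullbackFin f g p₁ p₂
  IsPullbackElt⇒IsPullbackFin pb = commutes pb , λ x h₁ h₂ h-sq →
    let lift : ∀ k → Σ (Fin p) λ z → p₁ z ≡ h₁ k × p₂ z ≡ h₂ k
        lift k = pair pb (h₁ k) (h₂ k) (h-sq k)
    in  proj₁ ∘ lift , proj₁ ∘ proj₂ ∘ lift , proj₂ ∘ proj₂ ∘ lift ,
        λ u' u'₁ u'₂ k → jointlyInjective pb (u' k) _
                           (trans (u'₁ k) (sym (proj₁ (proj₂ (lift k)))))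
                           (trans (u'₂ k) (sym (proj₂ (proj₂ (lift k)))))

  IsPullbackFin⇒IsPullbackElt : IsPullbackFin f g p₁ p₂ → IsPullbackElt f g p₁ p₂
  IsPullbackFin⇒IsPullbackElt (sq , universal) = record
    { commutes         = sq
    ; pair             = λ x y eq →
        let u , u₁ , u₂ , _ = universal 1 (λ _ → x) (λ _ → y) (λ _ → eq)
        in  u zero , u₁ zero , u₂ zero
    ; jointlyInjective = λ z z' eq₁ eq₂ →
        let _ , _ , _ , unique = universal 1 (λ _ → p₁ z) (λ _ → p₂ z) (λ _ → sq z)
        in  trans (unique (λ _ → z) (λ _ → refl) (λ _ → refl) zero)
                  (sym (unique (λ _ → z') (λ _ → sym eq₁) (λ _ → sym eq₂) zero))
    }

id-isPullback : ∀ {a c} (g : Fin a → Fin c) → IsPullbackElt id g g id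
id-isPullback g = record
  { commutes         = λ _ → refl
  ; pair             = λ x y eq → y , sym eq , refl
  ; jointlyInjective = λ _ _ _ eq → eq
  }

↑ˡ-isPullback : ∀ {a b c d} (f : Fin a → Fin c) (g : Fin b → Fin d) →
                IsPullbackElt (_↑ˡ d) (f ⊕ g) f (_↑ˡ b)
↑ˡ-isPullback {a} {b} {c} {d} f g = record
  { commutes         = sym ∘ ⊕-↑ˡ f g
  ; pair             = λ x → ↑-elim _
      (λ i eq → i , ↑ˡ-injective d _ _ (sym (trans eq (⊕-↑ˡ f g i))) , refl)
      (λ j eq → ⊥-elim (↑ˡ≢↑ʳ _ _ (trans eq (⊕-↑ʳ f g j))))
  ; jointlyInjective = λ z z' _ → ↑ˡ-injective b z z'
  }

↑ʳ-isPullback : ∀ {a b c d} (f : Fin a → Fin c) (g : Fin b → Fin d) →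
                IsPullbackElt (c ↑ʳ_) (f ⊕ g) g (a ↑ʳ_)
↑ʳ-isPullback {a} {b} {c} {d} f g = record
  { commutes         = sym ∘ ⊕-↑ʳ f g
  ; pair             = λ x → ↑-elim _
      (λ i eq → ⊥-elim (↑ˡ≢↑ʳ _ _ (sym (trans eq (⊕-↑ˡ f g i)))))
      (λ j eq → j , ↑ʳ-injective c _ _ (sym (trans eq (⊕-↑ʳ f g j))) , refl)
  ; jointlyInjective = λ z z' _ → ↑ʳ-injective a z z'
  }

copair-isPullback : ∀ {a₁ a₂ b c d₁ d₂} {f₁ : Fin a₁ → Fin c} {f₂ : Fin a₂ → Fin c} {g : Fin b → Fin c}
                    {r₁ : Fin d₁ → Fin a₁} {q₁ : Fin d₁ → Fin b} {r₂ : Fin d₂ → Fin a₂} {q₂ : Fin d₂ → Fin b} →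
                    IsPullbackElt f₁ g r₁ q₁ → IsPullbackElt f₂ g r₂ q₂ →
                    IsPullbackElt (copair f₁ f₂) g (r₁ ⊕ r₂) (copair q₁ q₂)
copair-isPullback {a₁} {a₂} {d₁ = d₁} {d₂} {f₁} {f₂} {g} {r₁} {q₁} {r₂} {q₂} pb₁ pb₂ = record
  { commutes         = copair-square f₁ f₂ g (commutes pb₁) (commutes pb₂)
  ; pair             = ↑-elim _ pairˡ pairʳ
  ; jointlyInjective = ↑-elim _
      (λ z → ↑-elim _
        (λ z' eq₁ eq₂ → cong (_↑ˡ d₂) (jointlyInjective pb₁ z z'
           (↑ˡ-injective a₂ _ _ (trans (sym (⊕-↑ˡ r₁ r₂ z)) (trans eq₁ (⊕-↑ˡ r₁ r₂ z'))))
           (trans (sym (copair-↑ˡ q₁ q₂ z)) (trans eq₂ (copair-↑ˡ q₁ q₂ z')))))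
        (λ z' eq₁ _ → ⊥-elim (↑ˡ≢↑ʳ _ _ (trans (sym (⊕-↑ˡ r₁ r₂ z)) (trans eq₁ (⊕-↑ʳ r₁ r₂ z'))))))
      (λ z → ↑-elim _
        (λ z' eq₁ _ → ⊥-elim (↑ˡ≢↑ʳ _ _ (trans (sym (⊕-↑ˡ r₁ r₂ z')) (trans (sym eq₁) (⊕-↑ʳ r₁ r₂ z)))))
        (λ z' eq₁ eq₂ → cong (d₁ ↑ʳ_) (jointlyInjective pb₂ z z'
           (↑ʳ-injective a₁ _ _ (trans (sym (⊕-↑ʳ r₁ r₂ z)) (trans eq₁ (⊕-↑ʳ r₁ r₂ z'))))
           (trans (sym (copair-↑ʳ q₁ q₂ z)) (trans eq₂ (copair-↑ʳ q₁ q₂ z'))))))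
  }
  where
  pairˡ : ∀ i y → copair f₁ f₂ (i ↑ˡ a₂) ≡ g y →
          Σ (Fin (d₁ + d₂)) λ z → (r₁ ⊕ r₂) z ≡ i ↑ˡ a₂ × copair q₁ q₂ z ≡ y
  pairˡ i y eq =
    let z , z₁ , z₂ = pair pb₁ i y (trans (sym (copair-↑ˡ f₁ f₂ i)) eq)
    in  z ↑ˡ d₂ , trans (⊕-↑ˡ r₁ r₂ z) (cong (_↑ˡ a₂) z₁) , trans (copair-↑ˡ q₁ q₂ z) z₂

  pairʳ : ∀ j y → copair f₁ f₂ (a₁ ↑ʳ j) ≡ g y →
          Σ (Fin (d₁ + d₂)) λ z → (r₁ ⊕ r₂) z ≡ a₁ ↑ʳ j × copair q₁ q₂ z ≡ y
  pairʳ j y eq =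
    let z , z₁ , z₂ = pair pb₂ j y (trans (sym (copair-↑ʳ f₁ f₂ j)) eq)
    in  d₁ ↑ʳ z , trans (⊕-↑ʳ r₁ r₂ z) (cong (a₁ ↑ʳ_) z₁) , trans (copair-↑ʳ q₁ q₂ z) z₂

Fibre : ∀ {a t} → (Fin a → Fin t) → Fin t → Set
Fibre {a} τ x = Σ (Fin a) λ i → τ i ≡ x

fibre-≡ : ∀ {a t} {τ : Fin a → Fin t} {x : Fin t} {u v : Fibre τ x} → proj₁ u ≡ proj₁ v → u ≡ v
fibre-≡ eq = Σ-≡,≡→≡ (eq , Decidable⇒UIP.≡-irrelevant _≟_ _ _)

module _ {a t m : ℕ} {τ : Fin a → Fin t} {x : Fin t} (e : Fin m ↔ Fibre τ x) where
  open Inverse e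

  from-injective : ∀ {u v} → from u ≡ from v → u ≡ v
  from-injective {u} {v} eq = trans (sym (strictlyInverseˡ u)) (trans (cong to eq) (strictlyInverseˡ v))

  fibre-isPullback : IsPullbackElt (λ (_ : Fin 1) → x) τ (λ _ → zero) (proj₁ ∘ to)
  fibre-isPullback = record
    { commutes         = sym ∘ proj₂ ∘ to
    ; pair             = λ { zero i eq → from (i , sym eq) , refl , cong proj₁ (strictlyInverseˡ (i , sym eq)) }
    ; jointlyInjective = λ j j' _ eq →
        trans (sym (strictlyInverseʳ j)) (trans (cong from (fibre-≡ eq)) (strictlyInverseʳ j'))
    }

-- One pullback square over each point x of Fin t, with its top side
-- indexed by an enumeration of the fibre of τ over x, glue to one square.
module FibreGluing {a t a' t' : ℕ} (τ : Fin a → Fin t) (τ' : Fin a' → Fin t')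
                   {m : Fin t → ℕ} (e : ∀ x → Fin (m x) ↔ Fibre τ x)
                   (ℓT : Fin t → Fin 1 → Fin t') (ℓA : ∀ x → Fin (m x) → Fin a')
                   (ℓ-pb : ∀ x → IsPullbackElt (ℓT x) τ' (λ _ → zero) (ℓA x)) where
  open Inverse

  glueT : Fin t → Fin t'
  glueT x = ℓT x zero

  glueA : Fin a → Fin a'
  glueA i = ℓA (τ i) (from (e (τ i)) (i , refl))

  glueA-fibre : ∀ x (u : Fibre τ x) → glueA (proj₁ u) ≡ ℓA x (from (e x) u)
  glueA-fibre _ (i , refl) = refl

  glueA-to : ∀ x j → glueA (proj₁ (to (e x) j)) ≡ ℓA x j
  glueA-to x j = trans (glueA-fibre x (to (e x) j)) (cong (ℓA x) (strictlyInverseʳ (e x) j))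

  glue-isPullback : IsPullbackElt glueT τ' τ glueA
  glue-isPullback = record
    { commutes         = λ i → commutes (ℓ-pb (τ i)) _
    ; pair             = λ x y eq →
        let j , _ , ℓAj≡y = pair (ℓ-pb x) zero y eq
        in  proj₁ (to (e x) j) , proj₂ (to (e x) j) , trans (glueA-to x j) ℓAj≡y
    ; jointlyInjective = λ i i' τi≡τi' glue≡ →
        let u = (i , refl) ; u' = (i' , sym τi≡τi')
        in  cong proj₁ (from-injective (e (τ i)) {u} {u'}
              (jointlyInjective (ℓ-pb (τ i)) _ _ refl (trans glue≡ (glueA-fibre (τ i) u'))))
    }

-- Colimits of finite sets

id-isCoequaliser : ∀ {u a} {f g : Fin u → Fin a} → f ≗ g → IsCoequaliserFin f g id
id-isCoequaliser f≗g = f≗g , λ x h _ → h , (λ _ → refl) , λ v' v'≗h → v'≗h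

-- Removing q with punchOut and sending it where p goes identifies q with p.
module Merge {n : ℕ} (f g : Fin 1 → Fin (suc n)) (p≢q : f zero ≢ g zero) where
  p q : Fin (suc n)
  p = f zero
  q = g zero

  merge : Fin (suc n) → Fin n
  merge x with x ≟ q
  ... | yes _   = punchOut (p≢q ∘ sym)
  ... | no  x≢q = punchOut (x≢q ∘ sym)

  merge-punchIn : ∀ y → merge (punchIn q y) ≡ y
  merge-punchIn y with punchIn q y ≟ q
  ... | yes q≡ = ⊥-elim (punchInᵢ≢i q y q≡)
  ... | no  _  = trans (punchOut-cong q refl) (punchOut-punchIn q)

  merge-glue : merge p ≡ merge q
  merge-glue with p ≟ q | q ≟ q
  ... | yes p≡q | _      = ⊥-elim (p≢q p≡q)
  ... | no  _   | yes _  = punchOut-cong q refl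
  ... | no  _   | no q≢q = ⊥-elim (q≢q refl)

  punchIn-merge : ∀ {X : Set} (h : Fin (suc n) → X) → h p ≡ h q → ∀ x → h (punchIn q (merge x)) ≡ h x
  punchIn-merge h hp≡hq x with x ≟ q
  ... | yes refl = trans (cong h (punchIn-punchOut _)) hp≡hq
  ... | no  _    = cong h (punchIn-punchOut _)

  merge-isCoequaliser : IsCoequaliserFin f g merge
  merge-isCoequaliser = (λ { zero → merge-glue }) , λ x h h-glue →
      h ∘ punchIn q
    , punchIn-merge h (h-glue zero)
    , λ v' v'≗h y → trans (cong v' (sym (merge-punchIn y))) (v'≗h (punchIn q y))

coequaliser-Fin1 : ∀ {n} (f g : Fin 1 → Fin n) → Σ ℕ λ k → Σ (Fin n → Fin k) (IsCoequaliserFin f g)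
coequaliser-Fin1 {zero} f g with () ← f zero
coequaliser-Fin1 {suc n} f g with f zero ≟ g zero
... | yes p≡q = suc n , id , id-isCoequaliser λ { zero → p≡q }
... | no  p≢q = n , merge , merge-isCoequaliser
  where open Merge f g p≢q

coequaliser⇒pushout : ∀ {u a b q} (f₁ : Fin u → Fin a) (f₂ : Fin u → Fin b) (c : Fin (a + b) → Fin q) →
                      IsCoequaliserFin ((_↑ˡ b) ∘ f₁) ((a ↑ʳ_) ∘ f₂) c →
                      IsPushoutFin f₁ f₂ (c ∘ (_↑ˡ b)) (c ∘ (a ↑ʳ_))
coequaliser⇒pushout f₁ f₂ c (c-glue , universal) = c-glue , λ x h₁ h₂ h-sq →
  let v , v∘c≗h , v-unique = universal x (copair h₁ h₂) (copair-glue h₁ h₂ h-sq)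
  in  v , ≗copair⇒↑ˡ v∘c≗h , ≗copair⇒↑ʳ v∘c≗h ,
      λ v' v'₁ v'₂ → v-unique v' (copair-unique (v' ∘ c) v'₁ v'₂)

module _ {P Q : Petri} where

  inSquare : (h : Hom P Q) → IsEtale h → IsPullbackElt (fT h) (inT Q) (inT P) (fI h)
  inSquare _ = IsPullbackFin⇒IsPullbackElt ∘ proj₁

  outSquare : (h : Hom P Q) → IsEtale h → IsPullbackElt (fT h) (outT Q) (outT P) (fO h)
  outSquare _ = IsPullbackFin⇒IsPullbackElt ∘ proj₂

  mkEtale : (h : Hom P Q) → IsPullbackElt (fT h) (inT Q) (inT P) (fI h) →
                             IsPullbackElt (fT h) (outT Q) (outT P) (fO h) → IsEtale h
  mkEtale _ inPb outPb = IsPullbackElt⇒IsPullbackFin inPb , IsPullbackElt⇒IsPullbackFin outPb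

-- Coproducts of Petri nets

infixr 6 _⊞_
_⊞_ : Petri → Petri → Petri
P₁ ⊞ P₂ = record
  { S = S P₁ + S P₂ ; I = I P₁ + I P₂ ; T = T P₁ + T P₂ ; O = O P₁ + O P₂
  ; inS  = inS P₁ ⊕ inS P₂  ; inT  = inT P₁ ⊕ inT P₂
  ; outT = outT P₁ ⊕ outT P₂ ; outS = outS P₁ ⊕ outS P₂
  }

module _ {P₁ P₂ : Petri} where

  injˡ : Hom P₁ (P₁ ⊞ P₂)
  injˡ = record
    { fS = _↑ˡ S P₂ ; fI = _↑ˡ I P₂ ; fT = _↑ˡ T P₂ ; fO = _↑ˡ O P₂
    ; sq-inS  = sym ∘ ⊕-↑ˡ (inS P₁) (inS P₂)
    ; sq-inT  = sym ∘ ⊕-↑ˡ (inT P₁) (inT P₂)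
    ; sq-outT = sym ∘ ⊕-↑ˡ (outT P₁) (outT P₂)
    ; sq-outS = sym ∘ ⊕-↑ˡ (outS P₁) (outS P₂)
    }

  injʳ : Hom P₂ (P₁ ⊞ P₂)
  injʳ = record
    { fS = S P₁ ↑ʳ_ ; fI = I P₁ ↑ʳ_ ; fT = T P₁ ↑ʳ_ ; fO = O P₁ ↑ʳ_
    ; sq-inS  = sym ∘ ⊕-↑ʳ (inS P₁) (inS P₂)
    ; sq-inT  = sym ∘ ⊕-↑ʳ (inT P₁) (inT P₂)
    ; sq-outT = sym ∘ ⊕-↑ʳ (outT P₁) (outT P₂)
    ; sq-outS = sym ∘ ⊕-↑ʳ (outS P₁) (outS P₂)
    }

  injˡ-etale : IsEtale injˡ
  injˡ-etale = mkEtale injˡ (↑ˡ-isPullback (inT P₁) (inT P₂)) (↑ˡ-isPullback (outT P₁) (outT P₂))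

  injʳ-etale : IsEtale injʳ
  injʳ-etale = mkEtale injʳ (↑ʳ-isPullback (inT P₁) (inT P₂)) (↑ʳ-isPullback (outT P₁) (outT P₂))

  [_,_]ᴴ : {Q : Petri} → Hom P₁ Q → Hom P₂ Q → Hom (P₁ ⊞ P₂) Q
  [_,_]ᴴ {Q} h₁ h₂ = record
    { fS = copair (fS h₁) (fS h₂) ; fI = copair (fI h₁) (fI h₂)
    ; fT = copair (fT h₁) (fT h₂) ; fO = copair (fO h₁) (fO h₂)
    ; sq-inS  = copair-square (fS h₁) (fS h₂) (inS Q) (sq-inS h₁) (sq-inS h₂)
    ; sq-inT  = copair-square (fT h₁) (fT h₂) (inT Q) (sq-inT h₁) (sq-inT h₂)
    ; sq-outT = copair-square (fT h₁) (fT h₂) (outT Q) (sq-outT h₁) (sq-outT h₂)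
    ; sq-outS = copair-square (fS h₁) (fS h₂) (outS Q) (sq-outS h₁) (sq-outS h₂)
    }

  module _ {Q : Petri} (h₁ : Hom P₁ Q) (h₂ : Hom P₂ Q) where

    [,]ᴴ-etale : IsEtale h₁ → IsEtale h₂ → IsEtale [ h₁ , h₂ ]ᴴ
    [,]ᴴ-etale e₁ e₂ = mkEtale [ h₁ , h₂ ]ᴴ (copair-isPullback (inSquare h₁ e₁) (inSquare h₂ e₂))
                                           (copair-isPullback (outSquare h₁ e₁) (outSquare h₂ e₂))

    [,]ᴴ-glue : {U : Petri} (f₁ : Hom U P₁) (f₂ : Hom U P₂) → (h₁ ∘H f₁) ≈H (h₂ ∘H f₂) →
                ([ h₁ , h₂ ]ᴴ ∘H injˡ ∘H f₁) ≈H ([ h₁ , h₂ ]ᴴ ∘H injʳ ∘H f₂)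
    [,]ᴴ-glue _ _ (s , i , t , o) =
      copair-glue (fS h₁) (fS h₂) s , copair-glue (fI h₁) (fI h₂) i ,
      copair-glue (fT h₁) (fT h₂) t , copair-glue (fO h₁) (fO h₂) o

    ≈[,]ᴴ⇒injˡ : (v : Hom (P₁ ⊞ P₂) Q) → v ≈H [ h₁ , h₂ ]ᴴ → (v ∘H injˡ) ≈H h₁
    ≈[,]ᴴ⇒injˡ _ (s , i , t , o) = ≗copair⇒↑ˡ s , ≗copair⇒↑ˡ i , ≗copair⇒↑ˡ t , ≗copair⇒↑ˡ o

    ≈[,]ᴴ⇒injʳ : (v : Hom (P₁ ⊞ P₂) Q) → v ≈H [ h₁ , h₂ ]ᴴ → (v ∘H injʳ) ≈H h₂
    ≈[,]ᴴ⇒injʳ _ (s , i , t , o) = ≗copair⇒↑ʳ s , ≗copair⇒↑ʳ i , ≗copair⇒↑ʳ t , ≗copair⇒↑ʳ o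

    [,]ᴴ-unique : (v : Hom (P₁ ⊞ P₂) Q) → (v ∘H injˡ) ≈H h₁ → (v ∘H injʳ) ≈H h₂ → v ≈H [ h₁ , h₂ ]ᴴ
    [,]ᴴ-unique v (s₁ , i₁ , t₁ , o₁) (s₂ , i₂ , t₂ , o₂) =
      copair-unique (fS v) s₁ s₂ , copair-unique (fI v) i₁ i₂ ,
      copair-unique (fT v) t₁ t₂ , copair-unique (fO v) o₁ o₂

coequaliser⇒pushoutᴾ : {U P₁ P₂ Q : Petri} (f₁ : Hom U P₁) (f₂ : Hom U P₂) (c : Hom (P₁ ⊞ P₂) Q) →
                       IsCoequaliserPetri (injˡ ∘H f₁) (injʳ ∘H f₂) c →
                       IsPushoutPetri f₁ f₂ (c ∘H injˡ) (c ∘H injʳ)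
coequaliser⇒pushoutᴾ f₁ f₂ c (c-glue , universal) = c-glue , λ Q' h₁ h₂ e₁ e₂ h-sq →
  let v , v-etale , v∘c≈h , v-unique =
        universal Q' [ h₁ , h₂ ]ᴴ ([,]ᴴ-etale h₁ h₂ e₁ e₂) ([,]ᴴ-glue h₁ h₂ f₁ f₂ h-sq)
  in  v , v-etale , ≈[,]ᴴ⇒injˡ h₁ h₂ (v ∘H c) v∘c≈h , ≈[,]ᴴ⇒injʳ h₁ h₂ (v ∘H c) v∘c≈h ,
      λ v' v'-etale v'₁ v'₂ → v-unique v' v'-etale ([,]ᴴ-unique h₁ h₂ (v' ∘H c) v'₁ v'₂)

pointwiseCoequaliser⇒pushout : {U P₁ P₂ Q : Petri} (f₁ : Hom U P₁) (f₂ : Hom U P₂) (c : Hom (P₁ ⊞ P₂) Q) →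
                               PointwiseCoequaliser (injˡ ∘H f₁) (injʳ ∘H f₂) c →
                               PointwisePushout f₁ f₂ (c ∘H injˡ) (c ∘H injʳ)
pointwiseCoequaliser⇒pushout f₁ f₂ c (s , i , t , o) =
  coequaliser⇒pushout (fS f₁) (fS f₂) (fS c) s , coequaliser⇒pushout (fI f₁) (fI f₂) (fI c) i ,
  coequaliser⇒pushout (fT f₁) (fT f₂) (fT c) t , coequaliser⇒pushout (fO f₁) (fO f₂) (fO c) o

-- Quotients of the places of a Petri net

module _ (P : Petri) {k : ℕ} (c : Fin (S P) → Fin k) where

  quotientPlaces : Petri
  quotientPlaces = record
    { S = k ; I = I P ; T = T P ; O = O P
    ; inS = c ∘ inS P ; inT = inT P ; outT = outT P ; outS = c ∘ outS P }

  quotientMap : Hom P quotientPlaces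
  quotientMap = record
    { fS = c ; fI = id ; fT = id ; fO = id
    ; sq-inS = λ _ → refl ; sq-inT = λ _ → refl ; sq-outT = λ _ → refl ; sq-outS = λ _ → refl }

  quotientMap-etale : IsEtale quotientMap
  quotientMap-etale = mkEtale quotientMap (id-isPullback (inT P)) (id-isPullback (outT P))

module _ {U P : Petri} (f g : Hom U P) (fI≗ : fI f ≗ fI g) (fT≗ : fT f ≗ fT g) (fO≗ : fO f ≗ fO g)
         {k : ℕ} {c : Fin (S P) → Fin k} (c-coeq : IsCoequaliserFin (fS f) (fS g) c) where

  quotientMap-isCoequaliser : IsCoequaliserPetri f g (quotientMap P c)
  quotientMap-isCoequaliser = (proj₁ c-coeq , fI≗ , fT≗ , fO≗) , λ Q' h h-etale h-glue →
    let v , v∘c≗h , v-unique = proj₂ c-coeq _ (fS h) (proj₁ h-glue)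
        mediator : Hom (quotientPlaces P c) Q'
        mediator = record
          { fS = v ; fI = fI h ; fT = fT h ; fO = fO h
          ; sq-inS  = λ i → trans (v∘c≗h (inS P i)) (sq-inS h i)
          ; sq-inT  = sq-inT h
          ; sq-outT = sq-outT h
          ; sq-outS = λ o → trans (v∘c≗h (outS P o)) (sq-outS h o) }
    -- mediator coincides with h on transitions and arcs, hence is etale as h is.
    in  mediator , h-etale , (v∘c≗h , (λ _ → refl) , (λ _ → refl) , λ _ → refl)
      , λ { v' _ (s , i , t , o) → v-unique (fS v') s , i , t , o }

  quotientMap-pointwise : PointwiseCoequaliser f g (quotientMap P c)
  quotientMap-pointwise = c-coeq , id-isCoequaliser fI≗ , id-isCoequaliser fT≗ , id-isCoequaliser fO≗

-- Petri nets as colimits of elementary graphs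

module ElementaryColimit (P : Petri) (m n : Fin (T P) → ℕ)
                         (ein  : (t : Fin (T P)) → Fin (m t) ↔ InArcs P t)
                         (eout : (t : Fin (T P)) → Fin (n t) ↔ OutArcs P t) where
  open Inverse

  D : Diagram
  D = elemDiagram P m n ein eout

  inArc : ∀ t → Fin (m t) → Fin (I P)
  inArc t = proj₁ ∘ to (ein t)

  outArc : ∀ t → Fin (n t) → Fin (O P)
  outArc t = proj₁ ∘ to (eout t)

  corollaLeg : ∀ t → Hom (corolla (m t) (n t)) P
  corollaLeg t = record
    { fS = copair (inS P ∘ inArc t) (outS P ∘ outArc t)
    ; fI = inArc t ; fT = λ _ → t ; fO = outArc t
    ; sq-inS  = copair-↑ˡ (inS P ∘ inArc t) (outS P ∘ outArc t)
    ; sq-inT  = sym ∘ proj₂ ∘ to (ein t)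
    ; sq-outT = sym ∘ proj₂ ∘ to (eout t)
    ; sq-outS = copair-↑ʳ (inS P ∘ inArc t) (outS P ∘ outArc t) }

  elemLeg : (x : V D) → Hom (obj D x) P
  elemLeg (inj₁ t) = corollaLeg t
  elemLeg (inj₂ p) = unitAt P p

  elemLeg-etale : (x : V D) → IsEtale (elemLeg x)
  elemLeg-etale (inj₁ t) = mkEtale (corollaLeg t) (fibre-isPullback (ein t)) (fibre-isPullback (eout t))
  elemLeg-etale (inj₂ p) = unit-etale (unitAt P p)

  elemLeg-commute : (e : E D) → (elemLeg (tgt D e) ∘H arr D e) ≈H elemLeg (src D e)
  elemLeg-commute (inj₁ i) =
    (λ _ → trans (copair-↑ˡ (inS P ∘ inArc _) (outS P ∘ outArc _) _)
                 (cong (inS P ∘ proj₁) (strictlyInverseˡ (ein _) (i , refl)))) ,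
    (λ ()) , (λ ()) , (λ ())
  elemLeg-commute (inj₂ o) =
    (λ _ → trans (copair-↑ʳ (inS P ∘ inArc _) (outS P ∘ outArc _) _)
                 (cong (outS P ∘ proj₁) (strictlyInverseˡ (eout _) (o , refl)))) ,
    (λ ()) , (λ ()) , (λ ())

  elemCocone : Cocone D P
  elemCocone = record { leg = elemLeg ; leg-etale = elemLeg-etale ; commute = elemLeg-commute }

  module Mediator (Q : Petri) (c : Cocone D Q) where
    L : ∀ t → Hom (corolla (m t) (n t)) Q
    L t = leg c (inj₁ t)

    module In  = FibreGluing (inT P)  (inT Q)  ein  (fT ∘ L) (fI ∘ L) (λ t → inSquare (L t) (leg-etale c (inj₁ t)))
    module Out = FibreGluing (outT P) (outT Q) eout (fT ∘ L) (fO ∘ L) (λ t → outSquare (L t) (leg-etale c (inj₁ t)))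

    vS : Fin (S P) → Fin (S Q)
    vS p = fS (leg c (inj₂ p)) zero

    vS-inS : ∀ i → vS (inS P i) ≡ inS Q (In.glueA i)
    vS-inS i = trans (sym (proj₁ (commute c (inj₁ i)) zero)) (sq-inS (L (inT P i)) _)

    vS-outS : ∀ o → vS (outS P o) ≡ outS Q (Out.glueA o)
    vS-outS o = trans (sym (proj₁ (commute c (inj₂ o)) zero)) (sq-outS (L (outT P o)) _)

    mediator : Hom P Q
    mediator = record
      { fS = vS ; fI = In.glueA ; fT = In.glueT ; fO = Out.glueA
      ; sq-inS = vS-inS ; sq-inT = commutes In.glue-isPullback
      ; sq-outT = commutes Out.glue-isPullback ; sq-outS = vS-outS }

    mediator-etale : IsEtale mediator
    mediator-etale = mkEtale mediator In.glue-isPullback Out.glue-isPullback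

    mediator-leg : (x : V D) → (mediator ∘H elemLeg x) ≈H leg c x
    mediator-leg (inj₂ p) = (λ { zero → refl }) , (λ ()) , (λ ()) , (λ ())
    mediator-leg (inj₁ t) = ↑-elim _ placeˡ placeʳ , In.glueA-to t , (λ { zero → refl }) , Out.glueA-to t
      where
      open ≡-Reasoning
      placeˡ : ∀ j → vS (fS (corollaLeg t) (j ↑ˡ n t)) ≡ fS (L t) (j ↑ˡ n t)
      placeˡ j = begin
        vS (fS (corollaLeg t) (j ↑ˡ n t)) ≡⟨ cong vS (copair-↑ˡ (inS P ∘ inArc t) (outS P ∘ outArc t) j) ⟩
        vS (inS P (inArc t j))            ≡⟨ vS-inS (inArc t j) ⟩
        inS Q (In.glueA (inArc t j))      ≡⟨ cong (inS Q) (In.glueA-to t j) ⟩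
        inS Q (fI (L t) j)                ≡⟨ sq-inS (L t) j ⟨
        fS (L t) (j ↑ˡ n t)               ∎
      placeʳ : ∀ j → vS (fS (corollaLeg t) (m t ↑ʳ j)) ≡ fS (L t) (m t ↑ʳ j)
      placeʳ j = begin
        vS (fS (corollaLeg t) (m t ↑ʳ j)) ≡⟨ cong vS (copair-↑ʳ (inS P ∘ inArc t) (outS P ∘ outArc t) j) ⟩
        vS (outS P (outArc t j))          ≡⟨ vS-outS (outArc t j) ⟩
        outS Q (Out.glueA (outArc t j))   ≡⟨ cong (outS Q) (Out.glueA-to t j) ⟩
        outS Q (fO (L t) j)               ≡⟨ sq-outS (L t) j ⟨
        fS (L t) (m t ↑ʳ j)               ∎

    mediator-unique : (v : Hom P Q) → IsEtale v → ((x : V D) → (v ∘H elemLeg x) ≈H leg c x) →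
                      v ≈H mediator
    mediator-unique v _ v-leg =
      (λ p → proj₁ (v-leg (inj₂ p)) zero) ,
      (λ i → trans (cong (fI v ∘ proj₁) (sym (strictlyInverseˡ (ein (inT P i)) (i , refl))))
                   (proj₁ (proj₂ (v-leg (inj₁ (inT P i)))) _)) ,
      (λ t → proj₁ (proj₂ (proj₂ (v-leg (inj₁ t)))) zero) ,
      (λ o → trans (cong (fO v ∘ proj₁) (sym (strictlyInverseˡ (eout (outT P o)) (o , refl))))
                   (proj₂ (proj₂ (proj₂ (v-leg (inj₁ (outT P o))))) _))

  elemCocone-isColimit : IsColimit D P elemCocone
  elemCocone-isColimit Q c = mediator , mediator-etale , mediator-leg , mediator-unique
    where open Mediator Q c

lemma2p7 :
    -- pushouts over unit graphs exist and are computed pointwise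
    ((P₁ P₂ : Petri) (f₁ : Hom unitNet P₁) (f₂ : Hom unitNet P₂) →
       IsEtale f₁ → IsEtale f₂ →
       Σ Petri λ Q → Σ (Hom P₁ Q) λ g₁ → Σ (Hom P₂ Q) λ g₂ →
         IsEtale g₁ × IsEtale g₂ × IsPushoutPetri f₁ f₂ g₁ g₂ ×
         PointwisePushout f₁ f₂ g₁ g₂)
    ×
    -- coequalisers over unit graphs exist and are computed pointwise
    ((P : Petri) (f g : Hom unitNet P) → IsEtale f → IsEtale g →
       Σ Petri λ Q → Σ (Hom P Q) λ c →
         IsEtale c × IsCoequaliserPetri f g c × PointwiseCoequaliser f g c)
    ×
    -- every Petri net is the colimit of its diagram of elementary graphs
    ((P : Petri) (m n : Fin (T P) → ℕ)
       (ein  : (t : Fin (T P)) → Fin (m t) ↔ InArcs P t)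
       (eout : (t : Fin (T P)) → Fin (n t) ↔ OutArcs P t) →
       Σ (Cocone (elemDiagram P m n ein eout) P) λ c →
         IsColimit (elemDiagram P m n ein eout) P c)
lemma2p7 =
    (λ P₁ P₂ f₁ f₂ _ _ →
       let g₁ = injˡ {P₁} {P₂} ∘H f₁
           g₂ = injʳ {P₁} {P₂} ∘H f₂
           _ , c , c-coeq = coequaliser-Fin1 (fS g₁) (fS g₂)
           q = quotientMap (P₁ ⊞ P₂) c
       -- q is the identity on transitions and arcs, so q ∘H injˡ is etale as injˡ is.
       in  quotientPlaces (P₁ ⊞ P₂) c , q ∘H injˡ , q ∘H injʳ , injˡ-etale {P₁} {P₂} , injʳ-etale {P₁} {P₂} ,
           coequaliser⇒pushoutᴾ f₁ f₂ q (quotientMap-isCoequaliser g₁ g₂ (λ ()) (λ ()) (λ ()) c-coeq) ,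
           pointwiseCoequaliser⇒pushout f₁ f₂ q (quotientMap-pointwise g₁ g₂ (λ ()) (λ ()) (λ ()) c-coeq))
  , (λ P f g _ _ →
       let _ , c , c-coeq = coequaliser-Fin1 (fS f) (fS g)
       in  quotientPlaces P c , quotientMap P c , quotientMap-etale P c ,
           quotientMap-isCoequaliser f g (λ ()) (λ ()) (λ ()) c-coeq ,
           quotientMap-pointwise f g (λ ()) (λ ()) (λ ()) c-coeq)
  , λ P m n ein eout →
       let open ElementaryColimit P m n ein eout in elemCocone , elemCocone-isColimit
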